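{- For infinitely many positive integers $n$, there exists an $n$-vertex $\Delta$-regular finite simple graph $G$ with $\chi_o(G)=n$ and $\Delta=\sqrt{8n+1}-3$.
   Context: An orientation of an undirected graph $G$ is an oriented graph (a directed graph with no parallel and no antiparallel arcs) whose underlying undirected graph is $G$. An oriented colouring of an oriented graph $D$ is a proper vertex colouring $c$ of its underlying graph such that there are no arcs $vw$ and $xy$ (directed from $v$ to $w$ and from $x$ to $y$) with $c(v)=c(y)$ and $c(w)=c(x)$. $\chi_o(D)$ is the minimum number of colours in an oriented colouring of $D$, and the oriented chromatic number $\chi_o(G)$ of an undirected graph $G$ is the maximum of $\chi_o(D)$ over all orientations $D$ of $G$. -}

module Defs where

open import Data.Nat using (ℕ; zero; suc; _+_; _*_; _≤_; _<_)
open import Data.Fin using (Fin)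
open import Data.Bool using (Bool; true; false; if_then_else_)
open import Data.List using (List; map; allFin)
open import Data.Nat.ListAction using (sum)
open import Data.Product using (Σ; _×_; ∃)
open import Relation.Binary.PropositionalEquality using (_≡_; _≢_)
open import Relation.Nullary using (¬_)
open import Data.Sum using (_⊎_)

record SimpleGraph (n : ℕ) : Set where
  field
    adj   : Fin n → Fin n → Bool
    sym   : ∀ v w → adj v w ≡ adj w v
    irrefl : ∀ v → adj v v ≡ false

open SimpleGraph public

Edge : ∀ {n} → SimpleGraph n → Fin n → Fin n → Set
Edge G v w = adj G v w ≡ true

degree : ∀ {n} → SimpleGraph n → Fin n → ℕ
degree {n} G v = sum (map (λ w → if adj G v w then 1 else 0) (allFin n))

Regular : ∀ {n} → SimpleGraph n → ℕ → Set
Regular {n} G Δ = ∀ (v : Fin n) → degree G v ≡ Δ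

Digraph : ℕ → Set
Digraph n = Fin n → Fin n → Bool

Arc : ∀ {n} → Digraph n → Fin n → Fin n → Set
Arc D v w = D v w ≡ true

-- D is an orientation of G: D is an oriented graph (no loops, no antiparallel
-- arcs; parallel arcs impossible in this representation) whose underlying
-- undirected graph is G.
IsOrientation : ∀ {n} → SimpleGraph n → Digraph n → Set
IsOrientation {n} G D =
  (∀ v w → Arc D v w → Edge G v w) ×
  (∀ v w → Arc D v w → ¬ Arc D w v) ×
  (∀ v w → Edge G v w → Arc D v w ⊎ Arc D w v)

IsOrientedColouring : ∀ {n k} → Digraph n → (Fin n → Fin k) → Set
IsOrientedColouring {n} D c =
  (∀ v w → Arc D v w → c v ≢ c w) ×
  (∀ v w x y → Arc D v w → Arc D x y → ¬ (c v ≡ c y × c w ≡ c x))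

OrientedColourable : ∀ {n} → Digraph n → ℕ → Set
OrientedColourable {n} D k = Σ (Fin n → Fin k) (λ c → IsOrientedColouring D c)

OrientedChromaticNumberDigraph : ∀ {n} → Digraph n → ℕ → Set
OrientedChromaticNumberDigraph D k =
  OrientedColourable D k × (∀ j → OrientedColourable D j → k ≤ j)

OrientedChromaticNumber : ∀ {n} → SimpleGraph n → ℕ → Set
OrientedChromaticNumber {n} G k =
  (Σ (Digraph n) (λ D → IsOrientation G D × OrientedChromaticNumberDigraph D k)) ×
  (∀ D → IsOrientation G D → ∀ j → OrientedChromaticNumberDigraph D j → j ≤ k)

{-# OPTIONS --safe #-}
-- For t ≥ 1 let n = 2t² + t and let S ⊆ ℤ/n consist of 1, …, t − 1 and t, 2t, …, t·t, so
-- |S| = 2t − 1.  Every element of S is at most t² < n/2, hence S ∩ (−S) = ∅ and the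
-- circulant graph on ℤ/n with jumps ±S is (4t − 2)-regular, with (4t + 1)² = 8n + 1.
-- Orient every edge x → x + s (s ∈ S).  Each residue 1, …, t² + t is a sum of at most two
-- elements of S, and for every nonzero residue d either d or −d is such a residue.  So any
-- two vertices are joined by a directed path of length at most 2; such vertices must get
-- different colours in every oriented colouring, whence χₒ ≥ n.  The bound χₒ ≤ n holds
-- for every graph on n vertices.
module Submission where

open import Defs
open import Data.Nat using (ℕ; _+_; _*_; _<_)
open import Data.Product using (Σ; _×_)
open import Relation.Binary.PropositionalEquality using (_≡_)

open import Data.Bool using (Bool; true; false; _∨_; if_then_else_)
open import Data.Bool.Properties using (∨-comm; ¬-not; T-≡)
open import Data.Empty using (⊥; ⊥-elim)
open import Data.Fin as Fin using (Fin; toℕ; fromℕ<)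
open import Data.Fin.Properties using (toℕ<n; toℕ-fromℕ<; toℕ-injective; injective⇒≤)
open import Data.List using (map; allFin; tabulate)
open import Data.List.Properties using (map-tabulate)
open import Data.Nat using (zero; suc; _∸_; _≤_; _<ᵇ_; z≤n; s≤s; s≤s⁻¹; z<s; s<s; _≟_; _≤?_; _<?_)
open import Data.Nat.DivMod
  using (_/_; _%_; m≡m%n+[m/n]*n; m%n<n; m*n/n≡m; m<n⇒m/n≡0; m<n⇒m%n≡m; +-distrib-/-∣ˡ; %-remove-+ˡ)
open import Data.Nat.Divisibility using (n∣m*n)
open import Data.Nat.ListAction using (sum)
open import Data.Nat.Properties
open import Algebra.Properties.CommutativeSemigroup +-commutativeSemigroup using (interchange; xy∙z≈xz∙y)
open import Data.Nat.Solver using (module +-*-Solver)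
open import Data.Product using (_,_; proj₁; proj₂; ∃-syntax; ∃₂)
open import Data.Sum using (_⊎_; inj₁; inj₂; [_,_])
import Data.Sum as Sum
open import Function using (id; _∘_)
open import Function.Bundles using (Equivalence)
open import Function.Definitions using (Injective)
import Relation.Binary.PropositionalEquality as ≡
open ≡ using (_≢_; refl; cong; cong₂; subst; subst₂; module ≡-Reasoning)
open import Relation.Nullary using (¬_; yes; no; contradiction)

private
  variable
    a d d′ e s₁ s₂ u x : ℕ

indicator : Bool → ℕ
indicator b = if b then 1 else 0

indicator-∨ : ∀ {b c} → (b ≡ true → c ≡ true → ⊥) → indicator (b ∨ c) ≡ indicator b + indicator c
indicator-∨ {true}  {true}  disjoint = ⊥-elim (disjoint refl refl)
indicator-∨ {true}  {false} _        = refl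
indicator-∨ {false}         _        = refl

∨-true⁻ : ∀ {b c} → b ∨ c ≡ true → b ≡ true ⊎ c ≡ true
∨-true⁻ {true}  _ = inj₁ refl
∨-true⁻ {false} c = inj₂ c

<⇒<ᵇ≡true : x < a → (x <ᵇ a) ≡ true
<⇒<ᵇ≡true x<a = Equivalence.to T-≡ (<⇒<ᵇ x<a)

<ᵇ≡true⇒< : (x <ᵇ a) ≡ true → x < a
<ᵇ≡true⇒< {x} {a} e = <ᵇ⇒< x a (Equivalence.from T-≡ e)

∑< : ℕ → (ℕ → ℕ) → ℕ
∑< zero    f = 0
∑< (suc n) f = f 0 + ∑< n (f ∘ suc)

syntax ∑< n (λ i → e) = ∑[ i < n ] e

∑-cong : ∀ n {f g : ℕ → ℕ} → (∀ i → i < n → f i ≡ g i) → ∑< n f ≡ ∑< n g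
∑-cong zero    _  = refl
∑-cong (suc n) eq = cong₂ _+_ (eq 0 z<s) (∑-cong n (λ i i<n → eq (suc i) (s<s i<n)))

∑-const : ∀ n c → ∑[ i < n ] c ≡ n * c
∑-const zero    c = refl
∑-const (suc n) c = cong (c +_) (∑-const n c)

∑-split : ∀ p q f → ∑< (p + q) f ≡ ∑< p f + ∑[ i < q ] f (p + i)
∑-split zero    q f = refl
∑-split (suc p) q f = ≡.trans (cong (f 0 +_) (∑-split p q (f ∘ suc))) (≡.sym (+-assoc (f 0) _ _))

∑-snoc : ∀ n f → ∑< (suc n) f ≡ ∑< n f + f n
∑-snoc zero    f = +-identityʳ (f 0)
∑-snoc (suc n) f = ≡.trans (cong (f 0 +_) (∑-snoc n (f ∘ suc))) (≡.sym (+-assoc (f 0) _ _))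

∑-distrib-+ : ∀ n f g → ∑[ i < n ] (f i + g i) ≡ ∑< n f + ∑< n g
∑-distrib-+ zero    f g = refl
∑-distrib-+ (suc n) f g =
  ≡.trans (cong (f 0 + g 0 +_) (∑-distrib-+ n (f ∘ suc) (g ∘ suc))) (interchange (f 0) (g 0) _ _)

∑-block : ∀ q t f → ∑< (q * t) f ≡ ∑[ j < q ] ∑[ r < t ] f (j * t + r)
∑-block zero    t f = refl
∑-block (suc q) t f = begin
  ∑< (t + q * t) f
    ≡⟨ ∑-split t (q * t) f ⟩
  ∑< t f + ∑[ i < q * t ] f (t + i)
    ≡⟨ cong (∑< t f +_) (∑-block q t (λ i → f (t + i))) ⟩
  ∑< t f + ∑[ j < q ] ∑[ r < t ] f (t + (j * t + r))
    ≡⟨ cong (∑< t f +_) (∑-cong q λ j _ → ∑-cong t λ r _ → cong f (≡.sym (+-assoc t (j * t) r))) ⟩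
  ∑< t f + ∑[ j < q ] ∑[ r < t ] f (t + j * t + r)
    ∎
  where open ≡-Reasoning

∑-reflect : ∀ n h → ∑[ i < n ] h (n ∸ i) + h 0 ≡ ∑< n h + h n
∑-reflect zero    h = refl
∑-reflect (suc n) h = begin
  h (suc n) + ∑[ i < n ] h (n ∸ i) + h 0    ≡⟨ +-assoc (h (suc n)) _ _ ⟩
  h (suc n) + (∑[ i < n ] h (n ∸ i) + h 0)  ≡⟨ cong (h (suc n) +_) (∑-reflect n h) ⟩
  h (suc n) + (∑< n h + h n)                ≡⟨ +-comm (h (suc n)) _ ⟩
  ∑< n h + h n + h (suc n)                  ≡⟨ cong (_+ h (suc n)) (∑-snoc n h) ⟨
  ∑< (suc n) h + h (suc n)                  ∎
  where open ≡-Reasoning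

∑-indicator-<ᵇ : ∀ t s → ∑[ q < t + s ] indicator (q <ᵇ t) ≡ t
∑-indicator-<ᵇ t s = begin
  ∑[ q < t + s ] indicator (q <ᵇ t)
    ≡⟨ ∑-split t s _ ⟩
  ∑[ q < t ] indicator (q <ᵇ t) + ∑[ i < s ] indicator (t + i <ᵇ t)
    ≡⟨ cong₂ _+_ (∑-cong t below) (∑-cong s above) ⟩
  ∑[ q < t ] 1 + ∑[ i < s ] 0
    ≡⟨ cong₂ _+_ (∑-const t 1) (∑-const s 0) ⟩
  t * 1 + s * 0
    ≡⟨ cong₂ _+_ (*-identityʳ t) (*-zeroʳ s) ⟩
  t + 0
    ≡⟨ +-identityʳ t ⟩
  t
    ∎
  where
  open ≡-Reasoning
  below : ∀ q → q < t → indicator (q <ᵇ t) ≡ 1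
  below q q<t = cong indicator (<⇒<ᵇ≡true q<t)
  above : ∀ i → i < s → indicator (t + i <ᵇ t) ≡ 0
  above i _ = cong indicator (¬-not λ t+i<t → <⇒≱ (<ᵇ≡true⇒< t+i<t) (m≤m+n t i))

sum-allFin : ∀ n (h : ℕ → ℕ) → sum (map (h ∘ toℕ) (allFin n)) ≡ ∑< n h
sum-allFin n h = ≡.trans (cong sum (map-tabulate {n = n} id (h ∘ toℕ))) (sum-tabulate n h)
  where
  sum-tabulate : ∀ n (h : ℕ → ℕ) → sum (tabulate {n = n} (h ∘ toℕ)) ≡ ∑< n h
  sum-tabulate zero    h = refl
  sum-tabulate (suc n) h = cong (h 0 +_) (sum-tabulate n (h ∘ suc))

module _ {n : ℕ} where

  Reach≤2 : Digraph n → Fin n → Fin n → Set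
  Reach≤2 D v w = Arc D v w ⊎ ∃[ u ] (Arc D v u × Arc D u w)

  OrientedClique : Digraph n → Set
  OrientedClique D = ∀ v w → v ≢ w → Reach≤2 D v w ⊎ Reach≤2 D w v

  id-isOrientedColouring : ∀ {G : SimpleGraph n} {D : Digraph n} →
                           IsOrientation G D → IsOrientedColouring D id
  id-isOrientedColouring {G} {D} (arc⇒edge , antisymmetric , _) = proper , noReversedPair
    where
    proper : ∀ v w → Arc D v w → v ≢ w
    proper v .v vv refl with ≡.trans (≡.sym (arc⇒edge v v vv)) (irrefl G v)
    ... | ()
    noReversedPair : ∀ v w x y → Arc D v w → Arc D x y → ¬ (v ≡ y × w ≡ x)
    noReversedPair v w .w .v vw wv (refl , refl) = antisymmetric v w vw wv

  reach≤2⇒colours-differ : ∀ {D : Digraph n} {k} {c : Fin n → Fin k} {v w} →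
                           IsOrientedColouring D c → Reach≤2 D v w → c v ≢ c w
  reach≤2⇒colours-differ (proper , _)         (inj₁ vw)           = proper _ _ vw
  reach≤2⇒colours-differ (_ , noReversedPair) (inj₂ (u , vu , uw)) cv≡cw =
    noReversedPair _ u u _ vu uw (cv≡cw , refl)

  orientedClique⇒colouring-injective : ∀ {D : Digraph n} {k} {c : Fin n → Fin k} →
                                       OrientedClique D → IsOrientedColouring D c → Injective _≡_ _≡_ c
  orientedClique⇒colouring-injective clique colouring {v} {w} cv≡cw with v Fin.≟ w
  ... | yes v≡w = v≡w
  ... | no  v≢w = ⊥-elim ([ (λ vw → reach≤2⇒colours-differ colouring vw cv≡cw)
                          , (λ wv → reach≤2⇒colours-differ colouring wv (≡.sym cv≡cw)) ] (clique v w v≢w))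

  orientedClique⇒oriented-chromatic-number : ∀ {G : SimpleGraph n} {D : Digraph n} →
                                             IsOrientation G D → OrientedClique D → OrientedChromaticNumber G n
  orientedClique⇒oriented-chromatic-number {G} {D} orientation clique =
    (D , orientation , (id , id-isOrientedColouring {G} orientation) ,
      λ k (_ , colouring) → injective⇒≤ (orientedClique⇒colouring-injective clique colouring)) ,
    λ D′ orientation′ k (_ , minimal) → minimal n (id , id-isOrientedColouring {G} orientation′)

module ModularDifference (n : ℕ) where

  data Offset (a d x : ℕ) : Set where
    direct  : a + d ≡ x     → Offset a d x
    wrapped : a + d ≡ x + n → Offset a d x

  diff : ℕ → ℕ → ℕ
  diff a x with a ≤? x
  ... | yes _ = x ∸ a
  ... | no  _ = n ∸ a + x

  diff-≤ : a ≤ x → diff a x ≡ x ∸ a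
  diff-≤ {a} {x} a≤x with a ≤? x
  ... | yes _   = refl
  ... | no  a≰x = contradiction a≤x a≰x

  diff-> : x < a → diff a x ≡ n ∸ a + x
  diff-> {x} {a} x<a with a ≤? x
  ... | yes a≤x = contradiction x<a (≤⇒≯ a≤x)
  ... | no  _   = refl

  diff-self : diff a a ≡ 0
  diff-self {a} = ≡.trans (diff-≤ {a} ≤-refl) (n∸n≡0 a)

  diff-offset : a ≤ n → Offset a (diff a x) x
  diff-offset {a} {x} a≤n with a ≤? x
  ... | yes a≤x = direct (m+[n∸m]≡n a≤x)
  ... | no  _   = wrapped (begin
    a + (n ∸ a + x)  ≡⟨ +-assoc a (n ∸ a) x ⟨
    a + (n ∸ a) + x  ≡⟨ cong (_+ x) (m+[n∸m]≡n a≤n) ⟩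
    n + x            ≡⟨ +-comm n x ⟩
    x + n            ∎)
    where open ≡-Reasoning

  diff-< : a ≤ n → x < n → diff a x < n
  diff-< {a} {x} a≤n x<n with a ≤? x
  ... | yes _   = ≤-<-trans (m∸n≤m x a) x<n
  ... | no  a≰x = begin-strict
    n ∸ a + x  <⟨ +-monoʳ-< (n ∸ a) (≰⇒> a≰x) ⟩
    n ∸ a + a  ≡⟨ m∸n+n≡m a≤n ⟩
    n          ∎
    where open ≤-Reasoning

  offset-no-wrap-around : a + d ≡ x → a + d′ ≡ x + n → d′ < n → ⊥
  offset-no-wrap-around {a} {d} {x} {d′} e e′ d′<n = <-irrefl refl (begin-strict
    x + n   ≡⟨ e′ ⟨
    a + d′  <⟨ +-monoʳ-< a d′<n ⟩
    a + n   ≤⟨ +-monoˡ-≤ n (subst (a ≤_) e (m≤m+n a d)) ⟩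
    x + n   ∎)
    where open ≤-Reasoning

  offset-unique : d < n → d′ < n → Offset a d x → Offset a d′ x → d ≡ d′
  offset-unique {a = a} _   _    (direct e) (direct e′) = +-cancelˡ-≡ a _ _ (≡.trans e (≡.sym e′))
  offset-unique {a = a} _   _    (wrapped e) (wrapped e′) = +-cancelˡ-≡ a _ _ (≡.trans e (≡.sym e′))
  offset-unique         _   d′<n (direct e) (wrapped e′) = ⊥-elim (offset-no-wrap-around e e′ d′<n)
  offset-unique         d<n _    (wrapped e) (direct e′) = ⊥-elim (offset-no-wrap-around e′ e d<n)

  diff-unique : a ≤ n → x < n → d < n → Offset a d x → diff a x ≡ d
  diff-unique a≤n x<n d<n offset = offset-unique (diff-< a≤n x<n) d<n (diff-offset a≤n) offset

  offset-flip : d ≤ n → Offset a d x → Offset x (n ∸ d) a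
  offset-flip {d} {a} {x} d≤n (direct e) = wrapped (begin
    x + (n ∸ d)      ≡⟨ cong (_+ (n ∸ d)) e ⟨
    a + d + (n ∸ d)  ≡⟨ +-assoc a d (n ∸ d) ⟩
    a + (d + (n ∸ d)) ≡⟨ cong (a +_) (m+[n∸m]≡n d≤n) ⟩
    a + n            ∎)
    where open ≡-Reasoning
  offset-flip {d} {a} {x} d≤n (wrapped e) = direct (+-cancelʳ-≡ d (x + (n ∸ d)) a (begin
    x + (n ∸ d) + d  ≡⟨ +-assoc x (n ∸ d) d ⟩
    x + (n ∸ d + d)  ≡⟨ cong (x +_) (m∸n+n≡m d≤n) ⟩
    x + n            ≡⟨ e ⟨
    a + d            ∎))
    where open ≡-Reasoning

  offset-zero : a < n → Offset a 0 x → a ≡ x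
  offset-zero {a}     _   (direct e) = ≡.trans (≡.sym (+-identityʳ a)) e
  offset-zero {a} {x} a<n (wrapped e) =
    contradiction (subst (n ≤_) (≡.trans (≡.sym e) (+-identityʳ a)) (m≤n+m n x)) (<⇒≱ a<n)

  diff-pos : a < n → a ≢ x → 0 < diff a x
  diff-pos {a} {x} a<n a≢x = n≢0⇒n>0 λ diff≡0 →
    a≢x (offset-zero a<n (subst (λ d → Offset a d x) diff≡0 (diff-offset (<⇒≤ a<n))))

  diff-swap : a < n → x < n → a ≢ x → diff x a ≡ n ∸ diff a x
  diff-swap {a} {x} a<n x<n a≢x = diff-unique (<⇒≤ x<n) a<n
    (∸-monoʳ-< (diff-pos a<n a≢x) d≤n) (offset-flip d≤n (diff-offset (<⇒≤ a<n)))
    where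
    d≤n : diff a x ≤ n
    d≤n = <⇒≤ (diff-< (<⇒≤ a<n) x<n)

  diff-+-diff : a < n → x < n → a ≢ x → diff a x + diff x a ≡ n
  diff-+-diff {a} {x} a<n x<n a≢x =
    ≡.trans (cong (diff a x +_) (diff-swap a<n x<n a≢x)) (m+[n∸m]≡n (<⇒≤ (diff-< (<⇒≤ a<n) x<n)))

  offset-exists : a < n → d < n → ∃[ x ] (x < n × Offset a d x)
  offset-exists {a} {d} a<n d<n with a + d <? n
  ... | yes a+d<n = a + d , a+d<n , direct refl
  ... | no  a+d≮n = a + d ∸ n , +-cancelʳ-< n (a + d ∸ n) n [a+d∸n]+n<n+n , wrapped (≡.sym [a+d∸n]+n≡a+d)
    where
    [a+d∸n]+n≡a+d : a + d ∸ n + n ≡ a + d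
    [a+d∸n]+n≡a+d = m∸n+n≡m (≮⇒≥ a+d≮n)
    [a+d∸n]+n<n+n : a + d ∸ n + n < n + n
    [a+d∸n]+n<n+n = subst (_< n + n) (≡.sym [a+d∸n]+n≡a+d) (+-mono-< a<n d<n)

  +-shift : ∀ a s₁ {s₂ y z} → a + s₁ ≡ y → a + (s₁ + s₂) ≡ z → y + s₂ ≡ z
  +-shift a s₁ {s₂} e₁ e₂ = ≡.trans (cong (_+ s₂) (≡.sym e₁)) (≡.trans (+-assoc a s₁ s₂) e₂)

  offset-cancel : x < n → Offset a s₁ u → Offset a (s₁ + s₂) x → Offset u s₂ x
  offset-cancel {a = a} {s₁} _ (direct e₁) (direct e₂)  = direct  (+-shift a s₁ e₁ e₂)
  offset-cancel {a = a} {s₁} _ (direct e₁) (wrapped e₂) = wrapped (+-shift a s₁ e₁ e₂)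
  offset-cancel {x} {a} {s₁} {u} {s₂} x<n (wrapped e₁) (direct e₂) =
    contradiction (subst (n ≤_) (+-shift a s₁ e₁ e₂) (≤-trans (m≤n+m n u) (m≤m+n (u + n) s₂))) (<⇒≱ x<n)
  offset-cancel {x} {a} {s₁} {u} {s₂} x<n (wrapped e₁) (wrapped e₂) =
    direct (+-cancelʳ-≡ n (u + s₂) x (≡.trans (xy∙z≈xz∙y u s₂ n) (+-shift a s₁ e₁ e₂)))

  diff-split : a < n → x < n → s₁ + s₂ ≡ diff a x →
               ∃[ u ] (u < n × diff a u ≡ s₁ × diff u x ≡ s₂)
  diff-split {a} {x} {s₁} {s₂} a<n x<n s₁+s₂≡diff =
    let u , u<n , a⟶u = offset-exists a<n s₁<n in
    u , u<n , diff-unique (<⇒≤ a<n) u<n s₁<n a⟶u ,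
              diff-unique (<⇒≤ u<n) x<n s₂<n (offset-cancel x<n a⟶u a⟶x)
    where
    s₁+s₂<n : s₁ + s₂ < n
    s₁+s₂<n = subst (_< n) (≡.sym s₁+s₂≡diff) (diff-< (<⇒≤ a<n) x<n)
    s₁<n : s₁ < n
    s₁<n = ≤-<-trans (m≤m+n s₁ s₂) s₁+s₂<n
    s₂<n : s₂ < n
    s₂<n = ≤-<-trans (m≤n+m s₂ s₁) s₁+s₂<n
    a⟶x : Offset a (s₁ + s₂) x
    a⟶x = subst (λ d → Offset a d x) (≡.sym s₁+s₂≡diff) (diff-offset (<⇒≤ a<n))

  ∑-diff : a ≤ n → ∀ h → ∑[ x < n ] h (diff a x) ≡ ∑< n h
  ∑-diff {a} a≤n h = begin
    ∑[ x < n ] h (diff a x)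
      ≡⟨ cong (λ N → ∑[ x < N ] h (diff a x)) (m+[n∸m]≡n a≤n) ⟨
    ∑[ x < a + (n ∸ a) ] h (diff a x)
      ≡⟨ ∑-split a (n ∸ a) _ ⟩
    ∑[ x < a ] h (diff a x) + ∑[ i < n ∸ a ] h (diff a (a + i))
      ≡⟨ cong₂ _+_ (∑-cong a below) (∑-cong (n ∸ a) above) ⟩
    ∑[ x < a ] h (n ∸ a + x) + ∑< (n ∸ a) h
      ≡⟨ +-comm _ (∑< (n ∸ a) h) ⟩
    ∑< (n ∸ a) h + ∑[ x < a ] h (n ∸ a + x)
      ≡⟨ ∑-split (n ∸ a) a h ⟨
    ∑< (n ∸ a + a) h
      ≡⟨ cong (λ N → ∑< N h) (m∸n+n≡m a≤n) ⟩
    ∑< n h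
      ∎
    where
    open ≡-Reasoning
    below : ∀ x → x < a → h (diff a x) ≡ h (n ∸ a + x)
    below x x<a = cong h (diff-> x<a)
    above : ∀ i → i < n ∸ a → h (diff a (a + i)) ≡ h i
    above i _ = cong h (≡.trans (diff-≤ (m≤m+n a i)) (m+n∸m≡n a i))

SumOfAtMostTwo : (ℕ → Bool) → ℕ → Set
SumOfAtMostTwo S d = S d ≡ true ⊎ ∃₂ λ s₁ s₂ → S s₁ ≡ true × S s₂ ≡ true × s₁ + s₂ ≡ d

module Circulant {n : ℕ} (S : ℕ → Bool)
                 (S-bounded : ∀ d → S d ≡ true → 0 < d × d < n)
                 (S-antisymmetric : ∀ d e → S d ≡ true → S e ≡ true → d + e ≢ n) where

  open ModularDifference n

  S-0 : S 0 ≡ false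
  S-0 = ¬-not λ S0 → <-irrefl refl (proj₁ (S-bounded 0 S0))

  S-n : S n ≡ false
  S-n = ¬-not λ Sn → <-irrefl refl (proj₂ (S-bounded n Sn))

  S-diff-self : S (diff a a) ≡ false
  S-diff-self {a} = ≡.trans (cong S (diff-self {a})) S-0

  no-arc-both-ways : a < n → x < n → S (diff a x) ≡ true → S (diff x a) ≡ true → ⊥
  no-arc-both-ways {a} {x} a<n x<n ax xa with a ≟ x
  ... | yes refl with ≡.trans (≡.sym ax) (S-diff-self {a})
  ...   | ()
  no-arc-both-ways {a} {x} a<n x<n ax xa | no a≢x =
    S-antisymmetric (diff a x) (diff x a) ax xa (diff-+-diff a<n x<n a≢x)

  S-diff-swap : a < n → x < n → S (diff x a) ≡ S (n ∸ diff a x)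
  S-diff-swap {a} {x} a<n x<n with a ≟ x
  ... | yes refl rewrite diff-self {a} = ≡.trans S-0 (≡.sym S-n)
  ... | no  a≢x  = cong S (diff-swap a<n x<n a≢x)

  δ : Fin n → Fin n → ℕ
  δ v w = diff (toℕ v) (toℕ w)

  orientation : Digraph n
  orientation v w = S (δ v w)

  graph : SimpleGraph n
  graph = record
    { adj    = λ v w → S (δ v w) ∨ S (δ w v)
    ; sym    = λ v w → ∨-comm (S (δ v w)) (S (δ w v))
    ; irrefl = λ v → cong₂ _∨_ (S-diff-self {toℕ v}) (S-diff-self {toℕ v})
    }

  orientation-isOrientation : IsOrientation graph orientation
  orientation-isOrientation =
    (λ v w vw → cong (_∨ S (δ w v)) vw) ,
    (λ v w → no-arc-both-ways (toℕ<n v) (toℕ<n w)) ,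
    (λ v w → ∨-true⁻)

  size : ℕ
  size = ∑[ d < n ] indicator (S d)

  ∑-S-reflected : ∑[ d < n ] indicator (S (n ∸ d)) ≡ size
  ∑-S-reflected = +-cancelʳ-≡ 0 _ _ (begin
    ∑[ d < n ] indicator (S (n ∸ d)) + 0
      ≡⟨ cong (λ b → ∑[ d < n ] indicator (S (n ∸ d)) + indicator b) S-0 ⟨
    ∑[ d < n ] indicator (S (n ∸ d)) + indicator (S 0)
      ≡⟨ ∑-reflect n (indicator ∘ S) ⟩
    size + indicator (S n)
      ≡⟨ cong (λ b → size + indicator b) S-n ⟩
    size + 0
      ∎)
    where open ≡-Reasoning

  graph-regular : Regular graph (size + size)
  graph-regular v = begin
    degree graph v
      ≡⟨ sum-allFin n (λ x → indicator (S (diff i x) ∨ S (diff x i))) ⟩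
    ∑[ x < n ] indicator (S (diff i x) ∨ S (diff x i))
      ≡⟨ ∑-cong n (λ x x<n → indicator-∨ (no-arc-both-ways i<n x<n)) ⟩
    ∑[ x < n ] (indicator (S (diff i x)) + indicator (S (diff x i)))
      ≡⟨ ∑-distrib-+ n _ _ ⟩
    ∑[ x < n ] indicator (S (diff i x)) + ∑[ x < n ] indicator (S (diff x i))
      ≡⟨ cong₂ _+_ (∑-diff i≤n (indicator ∘ S))
                   (∑-cong n (λ x x<n → cong indicator (S-diff-swap i<n x<n))) ⟩
    size + ∑[ x < n ] indicator (S (n ∸ diff i x))
      ≡⟨ cong (size +_) (∑-diff i≤n (λ d → indicator (S (n ∸ d)))) ⟩
    size + ∑[ d < n ] indicator (S (n ∸ d))
      ≡⟨ cong (size +_) ∑-S-reflected ⟩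
    size + size
      ∎
    where
    open ≡-Reasoning
    i : ℕ
    i = toℕ v
    i<n : i < n
    i<n = toℕ<n v
    i≤n : i ≤ n
    i≤n = <⇒≤ i<n

  sumOfAtMostTwo⇒reach≤2 : ∀ v w → SumOfAtMostTwo S (δ v w) → Reach≤2 orientation v w
  sumOfAtMostTwo⇒reach≤2 v w (inj₁ vw) = inj₁ vw
  sumOfAtMostTwo⇒reach≤2 v w (inj₂ (s₁ , s₂ , S-s₁ , S-s₂ , s₁+s₂≡δ)) =
    let u , u<n , δ-v-u , δ-u-w = diff-split (toℕ<n v) (toℕ<n w) s₁+s₂≡δ
        toℕ-u = toℕ-fromℕ< u<n
    in inj₂ (fromℕ< u<n ,
             ≡.trans (cong (λ y → S (diff (toℕ v) y)) toℕ-u) (≡.trans (cong S δ-v-u) S-s₁) ,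
             ≡.trans (cong (λ y → S (diff y (toℕ w))) toℕ-u) (≡.trans (cong S δ-u-w) S-s₂))

  orientation-orientedClique :
    (∀ d e → d + e ≡ n → 0 < d → 0 < e → SumOfAtMostTwo S d ⊎ SumOfAtMostTwo S e) →
    OrientedClique orientation
  orientation-orientedClique covering v w v≢w =
    Sum.map (sumOfAtMostTwo⇒reach≤2 v w) (sumOfAtMostTwo⇒reach≤2 w v)
      (covering (δ v w) (δ w v) (diff-+-diff v<n w<n toℕ-v≢w)
                (diff-pos v<n toℕ-v≢w) (diff-pos w<n (toℕ-v≢w ∘ ≡.sym)))
    where
    v<n : toℕ v < n
    v<n = toℕ<n v
    w<n : toℕ w < n
    w<n = toℕ<n w
    toℕ-v≢w : toℕ v ≢ toℕ w
    toℕ-v≢w = v≢w ∘ toℕ-injective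

module Construction (k : ℕ) where

  t : ℕ
  t = suc k

  n : ℕ
  n = suc (t + t) * t

  Δ : ℕ
  Δ = (k + t) + (k + t)

  [Δ+3]²≡8n+1 : (Δ + 3) * (Δ + 3) ≡ 8 * n + 1
  [Δ+3]²≡8n+1 = solve 1 (λ k → let t = con 1 :+ k; Δ = (k :+ t) :+ (k :+ t) in
                         (Δ :+ con 3) :* (Δ :+ con 3) := con 8 :* ((con 1 :+ (t :+ t)) :* t) :+ con 1) refl k
    where open +-*-Solver

  k<n : k < n
  k<n = s≤s (m≤m+n k _)

  n≡t²+t+t² : n ≡ t * t + t + t * t
  n≡t²+t+t² = solve 1 (λ t → (con 1 :+ (t :+ t)) :* t := t :* t :+ t :+ t :* t) refl t
    where open +-*-Solver

  -- shape q r decides whether q * t + r (with r < t) belongs to {1, …, t − 1} ∪ {t, 2t, …, t · t}.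
  shape : ℕ → ℕ → Bool
  shape zero    zero    = false
  shape zero    (suc _) = true
  shape (suc q) zero    = q <ᵇ t
  shape (suc q) (suc _) = false

  S : ℕ → Bool
  S d = shape (d / t) (d % t)

  S-shape : ∀ q {r} → r < t → S (q * t + r) ≡ shape q r
  S-shape q {r} r<t = cong₂ shape quotient remainder
    where
    open ≡-Reasoning
    quotient : (q * t + r) / t ≡ q
    quotient = begin
      (q * t + r) / t      ≡⟨ +-distrib-/-∣ˡ r (n∣m*n q) ⟩
      q * t / t + r / t    ≡⟨ cong₂ _+_ (m*n/n≡m q t) (m<n⇒m/n≡0 r<t) ⟩
      q + 0                ≡⟨ +-identityʳ q ⟩
      q                    ∎
    remainder : (q * t + r) % t ≡ r
    remainder = ≡.trans (%-remove-+ˡ r (n∣m*n q)) (m<n⇒m%n≡m r<t)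

  quotient-remainder : ∀ d → d ≡ d / t * t + d % t
  quotient-remainder d = ≡.trans (m≡m%n+[m/n]*n d t) (+-comm (d % t) _)

  t²+t≡[1+t]*t : t * t + t ≡ suc t * t
  t²+t≡[1+t]*t = +-comm (t * t) t

  shape-bounded : ∀ q r → r < t → shape q r ≡ true → 0 < q * t + r × q * t + r ≤ t * t
  shape-bounded zero    (suc r) r<t _ = z<s , ≤-trans (<⇒≤ r<t) (m≤m*n t t)
  shape-bounded (suc q) zero    _   e =
    z<s , subst (_≤ t * t) (≡.sym (+-identityʳ _)) (*-monoˡ-≤ t (<ᵇ≡true⇒< {q} {t} e))

  S-bounded-by-t² : ∀ d → S d ≡ true → 0 < d × d ≤ t * t
  S-bounded-by-t² d S-d = subst (λ y → 0 < y × y ≤ t * t) (≡.sym (quotient-remainder d))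
    (shape-bounded (d / t) (d % t) (m%n<n d t) S-d)

  S-residue : 0 < d → d < t → S d ≡ true
  S-residue {suc d} _ d<t = S-shape 0 d<t

  S-multiple : 0 < d → d ≤ t → S (d * t) ≡ true
  S-multiple {suc d} _ d<t =
    ≡.trans (cong S (≡.sym (+-identityʳ (suc d * t)))) (≡.trans (S-shape (suc d) z<s) (<⇒<ᵇ≡true d<t))

  shape-covers : ∀ q r → r < t → 0 < q * t + r → q * t + r ≤ t * t + t → SumOfAtMostTwo S (q * t + r)
  shape-covers zero    (suc r) r<t _ _ = inj₁ (S-residue z<s r<t)
  shape-covers (suc q) zero    _   _ bound with q <? t
  ... | yes q<t = inj₁ (≡.trans (S-shape (suc q) z<s) (<⇒<ᵇ≡true q<t))
  ... | no  q≮t = inj₂ (t * t , t , S-multiple z<s ≤-refl , S-t , t²+t≡[1+q]*t+0)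
    where
    S-t : S t ≡ true
    S-t = subst (λ y → S y ≡ true) (*-identityˡ t) (S-multiple z<s (s≤s z≤n))
    q≡t : q ≡ t
    q≡t = ≤-antisym (s≤s⁻¹ (*-cancelʳ-≤ (suc q) (suc t) t
            (subst₂ _≤_ (+-identityʳ _) t²+t≡[1+t]*t bound))) (≮⇒≥ q≮t)
    t²+t≡[1+q]*t+0 : t * t + t ≡ suc q * t + 0
    t²+t≡[1+q]*t+0 =
      ≡.trans t²+t≡[1+t]*t (≡.trans (cong (λ y → suc y * t) (≡.sym q≡t)) (≡.sym (+-identityʳ _)))
  shape-covers (suc q) (suc r) r<t _ bound =
    inj₂ (suc q * t , suc r , S-multiple z<s (s≤s⁻¹ q<t) , S-residue z<s r<t , refl)
    where
    q<t : suc q < suc t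
    q<t = *-cancelʳ-< t (suc q) (suc t) (begin-strict
      suc q * t            <⟨ m<m+n (suc q * t) z<s ⟩
      suc q * t + suc r    ≤⟨ bound ⟩
      t * t + t            ≡⟨ t²+t≡[1+t]*t ⟩
      suc t * t            ∎)
      where open ≤-Reasoning

  S-covers : 0 < d → d ≤ t * t + t → SumOfAtMostTwo S d
  S-covers {d} 0<d d≤t²+t = subst (SumOfAtMostTwo S) (≡.sym (quotient-remainder d))
    (shape-covers (d / t) (d % t) (m%n<n d t)
      (subst (0 <_) (quotient-remainder d) 0<d) (subst (_≤ t * t + t) (quotient-remainder d) d≤t²+t))

  t²<n : t * t < n
  t²<n = subst (t * t <_) (≡.sym n≡t²+t+t²) (<-≤-trans (m<m+n (t * t) z<s) (m≤m+n (t * t + t) (t * t)))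

  S-bounded : ∀ d → S d ≡ true → 0 < d × d < n
  S-bounded d S-d = proj₁ (S-bounded-by-t² d S-d) , ≤-<-trans (proj₂ (S-bounded-by-t² d S-d)) t²<n

  S-antisymmetric : ∀ d e → S d ≡ true → S e ≡ true → d + e ≢ n
  S-antisymmetric d e S-d S-e = <⇒≢ (begin-strict
    d + e              ≤⟨ +-mono-≤ (proj₂ (S-bounded-by-t² d S-d)) (proj₂ (S-bounded-by-t² e S-e)) ⟩
    t * t + t * t      <⟨ +-monoˡ-< (t * t) (m<m+n (t * t) z<s) ⟩
    t * t + t + t * t  ≡⟨ n≡t²+t+t² ⟨
    n                  ∎)
    where open ≤-Reasoning

  S-covers-residues : ∀ d e → d + e ≡ n → 0 < d → 0 < e → SumOfAtMostTwo S d ⊎ SumOfAtMostTwo S e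
  S-covers-residues d e d+e≡n 0<d 0<e with d ≤? t * t + t
  ... | yes d≤t²+t = inj₁ (S-covers 0<d d≤t²+t)
  ... | no  d≰t²+t = inj₂ (S-covers 0<e (≤-trans (<⇒≤ e<t²) (m≤m+n (t * t) t)))
    where
    e<t² : e < t * t
    e<t² = +-cancelˡ-< (t * t + t) e (t * t) (begin-strict
      t * t + t + e      <⟨ +-monoˡ-< e (≰⇒> d≰t²+t) ⟩
      d + e              ≡⟨ d+e≡n ⟩
      n                  ≡⟨ n≡t²+t+t² ⟩
      t * t + t + t * t  ∎)
      where open ≤-Reasoning

  open Circulant S S-bounded S-antisymmetric public

  size≡k+t : size ≡ k + t
  size≡k+t = begin
    ∑[ d < n ] indicator (S d)
      ≡⟨ ∑-block (suc (t + t)) t (indicator ∘ S) ⟩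
    ∑[ q < suc (t + t) ] ∑[ r < t ] indicator (S (q * t + r))
      ≡⟨ ∑-cong (suc (t + t)) (λ q _ → ∑-cong t λ r r<t → cong indicator (S-shape q r<t)) ⟩
    ∑[ q < suc (t + t) ] ∑[ r < t ] indicator (shape q r)
      ≡⟨ cong₂ _+_ first-row (∑-cong (t + t) λ q _ → later-row q) ⟩
    k + ∑[ q < t + t ] indicator (q <ᵇ t)
      ≡⟨ cong (k +_) (∑-indicator-<ᵇ t t) ⟩
    k + t
      ∎
    where
    open ≡-Reasoning
    first-row : ∑[ r < t ] indicator (shape 0 r) ≡ k
    first-row = ≡.trans (∑-const k 1) (*-identityʳ k)
    later-row : ∀ q → ∑[ r < t ] indicator (shape (suc q) r) ≡ indicator (q <ᵇ t)
    later-row q = ≡.trans (cong (indicator (q <ᵇ t) +_) (≡.trans (∑-const k 0) (*-zeroʳ k))) (+-identityʳ _)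

  graph-Δ-regular : Regular graph Δ
  graph-Δ-regular = subst (Regular graph) (cong₂ _+_ size≡k+t size≡k+t) graph-regular

lemma2 : ∀ (m : ℕ) → Σ ℕ (λ n → m < n × Σ ℕ (λ Δ → (Δ + 3) * (Δ + 3) ≡ 8 * n + 1 × Σ (SimpleGraph n) (λ G → Regular G Δ × OrientedChromaticNumber G n)))
lemma2 m = n , k<n , Δ , [Δ+3]²≡8n+1 , graph , graph-Δ-regular ,
  orientedClique⇒oriented-chromatic-number {G = graph} orientation-isOrientation
    (orientation-orientedClique S-covers-residues)
  where open Construction m
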